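{- Let $\mathfrak{a}_0,\mathfrak{b}_0$ be applications with $\mathfrak{a}_0\overset{JT}{\sim}\mathfrak{b}_0$, and write $f^0_j$ for the probability $\mathfrak{a}_0$ assigns to $\alpha^j$. Let $1\le m<n$, suppose there is $l$ with $1\le l\le m$ and $f^0_l\neq 0$, and suppose there is $k$ with $m+1\le k\le n$ and $f^0_k\neq 0$. Then there exist two infinite sequences of applications $\mathfrak{a}_0,\mathfrak{a}_1,\dots$ and $\mathfrak{b}_0,\mathfrak{b}_1,\dots$ such that for all $i$, $\mathfrak{a}_{i+1}\overset{WT}{\underset{m}{\leadsto}}\mathfrak{a}_i$ and $\mathfrak{b}_{i+1}\overset{WT}{\underset{m}{\leadsto}}\mathfrak{b}_i$, and for all $i\neq0$, it is not the case that $\mathfrak{a}_i\overset{ET}{\underset{m}{\sim}}\mathfrak{b}_i$.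
   Context: Fix an atomic target variable $a$ whose possible atomic values $\alpha^1,\dots,\alpha^n$ are exhaustive and pairwise mutually exclusive. An application $\mathfrak{a}$ of an ML system (a Training Set, a Learning Algorithm, a fixed input list of value attributions $\sigma$, and the target $a$) is identified with its output probability vector $(f_1,\dots,f_n)$, $f_i\in[0,1]$, $\sum_i f_i=1$, where $f_i$ is the probability assigned to $\alpha^i$; every such vector is the output of some application. For $\mathfrak{a}$ with $(f_i)$, $\mathfrak{b}$ with $(g_i)$ and $1\le m\le n$: $\mathfrak{a}\overset{JT}{\sim}\mathfrak{b}$ iff $f_i=g_i$ for all $i$; $\mathfrak{a}\overset{ET}{\underset{m}{\sim}}\mathfrak{b}$ iff $f_i=g_i$ for all $i\le m$; $\mathfrak{a}\overset{WT}{\underset{m}{\leadsto}}\mathfrak{b}$ iff $f_i\ge g_i$ for all $i\le m$ and, for every $i$, $f_i\neq 0\leftrightarrow g_i\neq0$. -}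

module Defs where

open import Level using (Level; _⊔_)
open import Algebra.Bundles using (CommutativeRing)
open import Relation.Binary.Structures using (IsTotalOrder)
open import Relation.Nullary using (¬_)
open import Data.Nat as ℕ using (ℕ)
open import Data.Fin using (Fin; zero; suc; toℕ)
open import Data.Product using (_×_)

-- An ordered field (the probabilities of the paper live in ℝ, which is one).
record OrderedField (c ℓ₁ ℓ₂ : Level) : Set (Level.suc (c ⊔ ℓ₁ ⊔ ℓ₂)) where
  field
    commutativeRing : CommutativeRing c ℓ₁
  open CommutativeRing commutativeRing public
  field
    _≤_          : Carrier → Carrier → Set ℓ₂
    isTotalOrder : IsTotalOrder _≈_ _≤_
    +-monoˡ-≤    : ∀ {x y} z → x ≤ y → (x + z) ≤ (y + z)
    *-nonneg     : ∀ {x y} → 0# ≤ x → 0# ≤ y → 0# ≤ (x * y)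
    0≉1          : ¬ (0# ≈ 1#)
    inv          : (x : Carrier) → ¬ (x ≈ 0#) → Carrier
    inv-correct  : ∀ x (x≉0 : ¬ (x ≈ 0#)) → (x * inv x x≉0) ≈ 1#

module _ {c ℓ₁ ℓ₂} (F : OrderedField c ℓ₁ ℓ₂) where
  open OrderedField F using (Carrier; _≈_; _≤_; _+_; 0#; 1#)

  sumF : ∀ {n} → (Fin n → Carrier) → Carrier
  sumF {ℕ.zero}  f = 0#
  sumF {ℕ.suc n} f = f zero + sumF (λ i → f (suc i))

  -- An application, identified with its output probability vector (f_1,…,f_n);
  -- index i : Fin n corresponds to the paper's α^(toℕ i + 1).
  record Application (n : ℕ) : Set (c ⊔ ℓ₁ ⊔ ℓ₂) where
    constructor app
    field
      prob    : Fin n → Carrier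
      prob≥0  : ∀ i → 0# ≤ prob i
      prob≤1  : ∀ i → prob i ≤ 1#
      sum≈1   : sumF prob ≈ 1#
  open Application public

  JT : ∀ {n} → Application n → Application n → Set ℓ₁
  JT a b = ∀ i → prob a i ≈ prob b i

  -- a ET∼_m b   (paper's i ≤ m  ⇔  toℕ i < m)
  ET : ∀ {n} → ℕ → Application n → Application n → Set ℓ₁
  ET m a b = ∀ i → toℕ i ℕ.< m → prob a i ≈ prob b i

  WT : ∀ {n} → ℕ → Application n → Application n → Set (ℓ₁ ⊔ ℓ₂)
  WT m a b = (∀ i → toℕ i ℕ.< m → prob b i ≤ prob a i)
           × (∀ i → (¬ (prob a i ≈ 0#) → ¬ (prob b i ≈ 0#))
                  × (¬ (prob b i ≈ 0#) → ¬ (prob a i ≈ 0#)))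

-- Weak transfer only asks the first m probabilities not to decrease and the support to stay the
-- same, so the a-sequence may stay constant, while the b-sequence moves half of the mass of an
-- outcome k > m onto an outcome l ≤ m and then stays put. Both outcomes are in the support, so the
-- support is unchanged, and the probability of α^l now differs between aᵢ and bᵢ for every i ≥ 1.
module Submission where

open import Defs
open import Level using (Level)
open import Relation.Nullary using (¬_; yes; no; contradiction)
open import Relation.Binary.PropositionalEquality as ≡ using (_≡_; _≢_)
open import Relation.Binary.Structures using (IsTotalOrder)
import Data.Nat as ℕ
import Data.Nat.Properties as ℕ
open import Data.Fin using (Fin; zero; suc; toℕ; punchIn)
open import Data.Fin.Properties using (_≟_; punchInᵢ≢i)
open import Data.Product using (Σ; _×_; ∃-syntax; _,_)
open import Data.Sum using (inj₁; inj₂)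
open import Function using (id; _∘_)
import Algebra.Properties.Ring as RingProperties
import Algebra.Properties.Group as GroupProperties
import Algebra.Properties.CommutativeMonoid.Sum as SumProperties
import Relation.Binary.Reasoning.Setoid as SetoidReasoning

module OrderedFieldProperties {c ℓ₁ ℓ₂ : Level} (F : OrderedField c ℓ₁ ℓ₂) where

  open OrderedField F hiding (zero)
  open IsTotalOrder isTotalOrder public
    using (total; antisym; ≤-respˡ-≈; ≤-respʳ-≈)
    renaming (refl to ≤-refl; trans to ≤-trans)
  open RingProperties ring using (-‿distribˡ-*; -‿distribʳ-*; x+x≈x⇒x≈0)
  open GroupProperties +-group using (⁻¹-involutive)
  open SetoidReasoning setoid

  +-monoʳ-≤ : ∀ {x y} z → x ≤ y → (z + x) ≤ (z + y)
  +-monoʳ-≤ {x} {y} z x≤y =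
    ≤-respˡ-≈ (+-comm x z) (≤-respʳ-≈ (+-comm y z) (+-monoˡ-≤ z x≤y))

  x≤x+y : ∀ x {y} → 0# ≤ y → x ≤ (x + y)
  x≤x+y x 0≤y = ≤-respˡ-≈ (+-identityʳ x) (+-monoʳ-≤ x 0≤y)

  +-nonneg : ∀ {x y} → 0# ≤ x → 0# ≤ y → 0# ≤ (x + y)
  +-nonneg {x} 0≤x 0≤y = ≤-trans 0≤x (x≤x+y x 0≤y)

  x≤y⇒0≤y-x : ∀ {x y} → x ≤ y → 0# ≤ (y - x)
  x≤y⇒0≤y-x {x} x≤y = ≤-respˡ-≈ (-‿inverseʳ x) (+-monoˡ-≤ (- x) x≤y)

  nonneg-+-≈0⇒≈0 : ∀ {x y} → 0# ≤ x → 0# ≤ y → x + y ≈ 0# → x ≈ 0#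
  nonneg-+-≈0⇒≈0 {x} 0≤x 0≤y x+y≈0 = antisym (≤-respʳ-≈ x+y≈0 (x≤x+y x 0≤y)) 0≤x

  -x*-x≈x*x : ∀ x → (- x) * (- x) ≈ x * x
  -x*-x≈x*x x = begin
    (- x) * (- x)    ≈⟨ -‿distribˡ-* x (- x) ⟨
    - (x * (- x))    ≈⟨ -‿cong (-‿distribʳ-* x x) ⟨
    - (- (x * x))    ≈⟨ ⁻¹-involutive (x * x) ⟩
    x * x            ∎

  x*x-nonneg : ∀ x → 0# ≤ (x * x)
  x*x-nonneg x with total 0# x
  ... | inj₁ 0≤x = *-nonneg 0≤x 0≤x
  ... | inj₂ x≤0 = ≤-respʳ-≈ (-x*-x≈x*x x) (*-nonneg 0≤-x 0≤-x)
    where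
    0≤-x : 0# ≤ (- x)
    0≤-x = ≤-respʳ-≈ (+-identityˡ (- x)) (x≤y⇒0≤y-x x≤0)

  0≤1 : 0# ≤ 1#
  0≤1 = ≤-respʳ-≈ (*-identityˡ 1#) (x*x-nonneg 1#)

  1+1≉0 : ¬ (1# + 1# ≈ 0#)
  1+1≉0 1+1≈0 = 0≉1 (sym (nonneg-+-≈0⇒≈0 0≤1 0≤1 1+1≈0))

  ½ : Carrier
  ½ = inv (1# + 1#) 1+1≉0

  x*½+x*½≈x : ∀ x → x * ½ + x * ½ ≈ x
  x*½+x*½≈x x = begin
    x * ½ + x * ½   ≈⟨ distribˡ x ½ ½ ⟨
    x * (½ + ½)     ≈⟨ *-congˡ ½+½≈1 ⟩
    x * 1#          ≈⟨ *-identityʳ x ⟩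
    x               ∎
    where
    ½+½≈1 : ½ + ½ ≈ 1#
    ½+½≈1 = begin
      ½ + ½                 ≈⟨ +-cong (*-identityˡ ½) (*-identityˡ ½) ⟨
      1# * ½ + 1# * ½       ≈⟨ distribʳ ½ 1# 1# ⟨
      (1# + 1#) * ½         ≈⟨ inv-correct (1# + 1#) 1+1≉0 ⟩
      1#                    ∎

  0≤½ : 0# ≤ ½
  0≤½ = ≤-respʳ-≈ (x*½+x*½≈x ½) (+-nonneg (x*x-nonneg ½) (x*x-nonneg ½))

  x*½-nonneg : ∀ {x} → 0# ≤ x → 0# ≤ (x * ½)
  x*½-nonneg 0≤x = *-nonneg 0≤x 0≤½

  x*½≤x : ∀ {x} → 0# ≤ x → (x * ½) ≤ x
  x*½≤x {x} 0≤x = ≤-respʳ-≈ (x*½+x*½≈x x) (x≤x+y (x * ½) (x*½-nonneg 0≤x))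

  x*½≈0⇒x≈0 : ∀ {x} → x * ½ ≈ 0# → x ≈ 0#
  x*½≈0⇒x≈0 {x} x*½≈0 = begin
    x               ≈⟨ x*½+x*½≈x x ⟨
    x * ½ + x * ½   ≈⟨ +-cong x*½≈0 x*½≈0 ⟩
    0# + 0#         ≈⟨ +-identityˡ 0# ⟩
    0#              ∎

  x*½≈x⇒x≈0 : ∀ {x} → x * ½ ≈ x → x ≈ 0#
  x*½≈x⇒x≈0 {x} x*½≈x =
    x*½≈0⇒x≈0 (x+x≈x⇒x≈0 (x * ½) (trans (x*½+x*½≈x x) (sym x*½≈x)))

module FiniteSums {c ℓ₁ ℓ₂ : Level} (F : OrderedField c ℓ₁ ℓ₂) where

  open OrderedField F hiding (zero)
  open OrderedFieldProperties F
  open SumProperties +-commutativeMonoid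
    using (sum; sum-cong-≋; sum-replicate-zero; sum-remove; ∑-distrib-+)

  sumF≡sum : ∀ {n} (f : Fin n → Carrier) → sumF F f ≡ sum f
  sumF≡sum {ℕ.zero}  f = ≡.refl
  sumF≡sum {ℕ.suc n} f = ≡.cong (f zero +_) (sumF≡sum (λ i → f (suc i)))

  sumF-+ : ∀ {n} (f g : Fin n → Carrier) → sumF F (λ i → f i + g i) ≈ (sumF F f + sumF F g)
  sumF-+ f g rewrite sumF≡sum f | sumF≡sum g | sumF≡sum (λ i → f i + g i) = ∑-distrib-+ f g

  sumF-remove : ∀ {n} (f : Fin (ℕ.suc n) → Carrier) j →
                sumF F f ≈ (f j + sumF F (λ i → f (punchIn j i)))
  sumF-remove f j rewrite sumF≡sum f | sumF≡sum (λ i → f (punchIn j i)) = sum-remove {i = j} f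

  sumF-zero : ∀ {n} (f : Fin n → Carrier) → (∀ i → f i ≈ 0#) → sumF F f ≈ 0#
  sumF-zero {n} f f≈0 rewrite sumF≡sum f = trans (sum-cong-≋ f≈0) (sum-replicate-zero n)

  sumF-nonneg : ∀ {n} (f : Fin n → Carrier) → (∀ i → 0# ≤ f i) → 0# ≤ sumF F f
  sumF-nonneg {ℕ.zero}  f 0≤f = ≤-refl
  sumF-nonneg {ℕ.suc n} f 0≤f =
    +-nonneg (0≤f zero) (sumF-nonneg (λ i → f (suc i)) (λ i → 0≤f (suc i)))

  ≤-sumF : ∀ {n} (f : Fin n → Carrier) → (∀ i → 0# ≤ f i) → ∀ j → f j ≤ sumF F f
  ≤-sumF {ℕ.suc n} f 0≤f j =
    ≤-respʳ-≈ (sym (sumF-remove f j))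
      (x≤x+y (f j) (sumF-nonneg (λ i → f (punchIn j i)) (λ i → 0≤f (punchIn j i))))

  pointMass : ∀ {n} → Fin n → Carrier → Fin n → Carrier
  pointMass j x i with i ≟ j
  ... | yes _ = x
  ... | no  _ = 0#

  pointMass-same : ∀ {n} (j : Fin n) x → pointMass j x j ≈ x
  pointMass-same j x with j ≟ j
  ... | yes _   = refl
  ... | no  j≢j = contradiction ≡.refl j≢j

  pointMass-other : ∀ {n} {i j : Fin n} x → i ≢ j → pointMass j x i ≈ 0#
  pointMass-other {i = i} {j} x i≢j with i ≟ j
  ... | yes i≡j = contradiction i≡j i≢j
  ... | no  _   = refl

  sumF-pointMass : ∀ {n} (j : Fin n) x → sumF F (pointMass j x) ≈ x
  sumF-pointMass {ℕ.suc n} j x = begin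
    sumF F (pointMass j x)
      ≈⟨ sumF-remove (pointMass j x) j ⟩
    pointMass j x j + sumF F (λ i → pointMass j x (punchIn j i))
      ≈⟨ +-cong (pointMass-same j x) zeros ⟩
    x + 0#
      ≈⟨ +-identityʳ x ⟩
    x
      ∎
    where
    open SetoidReasoning setoid
    zeros : sumF F (λ i → pointMass j x (punchIn j i)) ≈ 0#
    zeros = sumF-zero _ (λ i → pointMass-other x (punchInᵢ≢i j i))

toℕ<⇒≤toℕ⇒≢ : ∀ {n m} {i j : Fin n} → toℕ i ℕ.< m → m ℕ.≤ toℕ j → i ≢ j
toℕ<⇒≤toℕ⇒≢ i<m m≤j ≡.refl = ℕ.<-irrefl ≡.refl (ℕ.<-≤-trans i<m m≤j)

WT-refl : ∀ {c ℓ₁ ℓ₂} (F : OrderedField c ℓ₁ ℓ₂) {n} m (a : Application F n) → WT F m a a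
WT-refl F m a = (λ _ _ → IsTotalOrder.refl (OrderedField.isTotalOrder F)) , (λ _ → id , id)

module Transfer {c ℓ₁ ℓ₂ : Level} (F : OrderedField c ℓ₁ ℓ₂)
  {n : ℕ.ℕ} (a : Application F n)
  {l k : Fin n} (l≢k : l ≢ k) (ε : OrderedField.Carrier F)
  (0≤ε : OrderedField._≤_ F (OrderedField.0# F) ε) (ε≤fk : OrderedField._≤_ F ε (prob a k)) where

  open OrderedField F hiding (zero)
  open OrderedFieldProperties F
  open FiniteSums F
  open GroupProperties +-group using (identityʳ-unique; x∙y⁻¹≈ε⇒x≈y)
  open SetoidReasoning setoid

  f : Fin n → Carrier
  f = prob a

  shift : Fin n → Carrier
  shift i = pointMass l ε i + pointMass k (- ε) i

  shift-target : shift l ≈ ε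
  shift-target =
    trans (+-cong (pointMass-same l ε) (pointMass-other (- ε) l≢k)) (+-identityʳ ε)

  shift-source : shift k ≈ (- ε)
  shift-source =
    trans (+-cong (pointMass-other ε (l≢k ∘ ≡.sym)) (pointMass-same k (- ε))) (+-identityˡ (- ε))

  shift-other : ∀ {i} → i ≢ l → i ≢ k → shift i ≈ 0#
  shift-other i≢l i≢k =
    trans (+-cong (pointMass-other ε i≢l) (pointMass-other (- ε) i≢k)) (+-identityˡ 0#)

  sumF-shift : sumF F shift ≈ 0#
  sumF-shift = begin
    sumF F shift
      ≈⟨ sumF-+ (pointMass l ε) (pointMass k (- ε)) ⟩
    sumF F (pointMass l ε) + sumF F (pointMass k (- ε))
      ≈⟨ +-cong (sumF-pointMass l ε) (sumF-pointMass k (- ε)) ⟩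
    ε - ε
      ≈⟨ -‿inverseʳ ε ⟩
    0#
      ∎

  transferred : Fin n → Carrier
  transferred i = f i + shift i

  transferred-target : transferred l ≈ (f l + ε)
  transferred-target = +-congˡ shift-target

  transferred-source : transferred k ≈ (f k - ε)
  transferred-source = +-congˡ shift-source

  transferred-other : ∀ {i} → i ≢ l → i ≢ k → transferred i ≈ f i
  transferred-other {i} i≢l i≢k = trans (+-congˡ (shift-other i≢l i≢k)) (+-identityʳ (f i))

  target-source-cases : ∀ {p} (P : Fin n → Set p) →
    P l → P k → (∀ {i} → i ≢ l → i ≢ k → P i) → ∀ i → P i
  target-source-cases P Pl Pk Pother i with i ≟ l | i ≟ k
  ... | yes ≡.refl | _          = Pl
  ... | no _       | yes ≡.refl = Pk
  ... | no i≢l     | no i≢k     = Pother i≢l i≢k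

  transferred-nonneg : ∀ i → 0# ≤ transferred i
  transferred-nonneg = target-source-cases (λ i → 0# ≤ transferred i)
    (≤-respʳ-≈ (sym transferred-target) (+-nonneg (prob≥0 a l) 0≤ε))
    (≤-respʳ-≈ (sym transferred-source) (x≤y⇒0≤y-x ε≤fk))
    (λ {i} i≢l i≢k → ≤-respʳ-≈ (sym (transferred-other i≢l i≢k)) (prob≥0 a i))

  sumF-transferred : sumF F transferred ≈ 1#
  sumF-transferred = begin
    sumF F transferred           ≈⟨ sumF-+ f shift ⟩
    sumF F f + sumF F shift      ≈⟨ +-cong (sum≈1 a) sumF-shift ⟩
    1# + 0#                      ≈⟨ +-identityʳ 1# ⟩
    1#                           ∎

  transfer : Application F n
  transfer = app transferred transferred-nonneg
    (λ i → ≤-respʳ-≈ sumF-transferred (≤-sumF transferred transferred-nonneg i))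
    sumF-transferred

  transfer-mono : ∀ i → i ≢ k → f i ≤ transferred i
  transfer-mono = target-source-cases (λ i → i ≢ k → f i ≤ transferred i)
    (λ _ → ≤-respʳ-≈ (sym transferred-target) (x≤x+y (f l) 0≤ε))
    (λ k≢k → contradiction ≡.refl k≢k)
    (λ i≢l i≢k _ → ≤-respʳ-≈ (sym (transferred-other i≢l i≢k)) ≤-refl)

  transfer-support : ¬ (f l ≈ 0#) → ¬ (ε ≈ f k) → ∀ i →
    (¬ (transferred i ≈ 0#) → ¬ (f i ≈ 0#)) × (¬ (f i ≈ 0#) → ¬ (transferred i ≈ 0#))
  transfer-support fl≉0 ε≉fk = target-source-cases _
    ( (λ _ → fl≉0)
    , (λ _ gl≈0 → fl≉0 (nonneg-+-≈0⇒≈0 (prob≥0 a l) 0≤ε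
                         (trans (sym transferred-target) gl≈0))))
    ( (λ _ fk≈0 → ε≉fk (trans (antisym (≤-respʳ-≈ fk≈0 ε≤fk) 0≤ε) (sym fk≈0)))
    , (λ _ gk≈0 → ε≉fk (sym (x∙y⁻¹≈ε⇒x≈y (f k) ε
                               (trans (sym transferred-source) gk≈0)))))
    (λ i≢l i≢k →
      (λ g≉0 f≈0 → g≉0 (trans (transferred-other i≢l i≢k) f≈0)) ,
      (λ f≉0 g≈0 → f≉0 (trans (sym (transferred-other i≢l i≢k)) g≈0)))

  transferred-target≉ : ¬ (ε ≈ 0#) → ¬ (transferred l ≈ f l)
  transferred-target≉ ε≉0 gl≈fl =
    ε≉0 (identityʳ-unique (f l) ε (trans (sym transferred-target) gl≈fl))

  transfer-WT : ∀ {m} → m ℕ.≤ toℕ k → ¬ (f l ≈ 0#) → ¬ (ε ≈ f k) → WT F m transfer a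
  transfer-WT m≤k fl≉0 ε≉fk =
    (λ i i<m → transfer-mono i (toℕ<⇒≤toℕ⇒≢ i<m m≤k)) , transfer-support fl≉0 ε≉fk

open import Data.Nat using (ℕ; zero; suc; _≤_; _<_)

mainTheorem5 : ∀ {c ℓ₁ ℓ₂} (F : OrderedField c ℓ₁ ℓ₂) (n m : ℕ)
    (a₀ b₀ : Application F n) →
    JT F a₀ b₀ →
    1 ≤ m → m < n →
    (∃[ l ] (toℕ l < m × ¬ (OrderedField._≈_ F (prob a₀ l) (OrderedField.0# F)))) →
    (∃[ k ] (m ≤ toℕ k × ¬ (OrderedField._≈_ F (prob a₀ k) (OrderedField.0# F)))) →
    Σ (ℕ → Application F n) λ a → Σ (ℕ → Application F n) λ b →
      (a 0 ≡ a₀) × (b 0 ≡ b₀) ×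
      (∀ i → WT F m (a (suc i)) (a i)) ×
      (∀ i → WT F m (b (suc i)) (b i)) ×
      (∀ i → ¬ (i ≡ 0) → ¬ ET F m (a i) (b i))
mainTheorem5 F n m a₀ b₀ a₀≈b₀ _ _ (l , l<m , a₀l≉0) (k , m≤k , a₀k≉0) =
  (λ _ → a₀) , b , ≡.refl , ≡.refl , (λ _ → WT-refl F m a₀) , b-WT , a≉b
  where
  open OrderedField F using (_≈_; _*_; 0#; sym; trans)
  open OrderedFieldProperties F

  b₀k≉0 : ¬ (prob b₀ k ≈ 0#)
  b₀k≉0 = a₀k≉0 ∘ trans (a₀≈b₀ k)

  open Transfer F b₀ (toℕ<⇒≤toℕ⇒≢ l<m m≤k) (prob b₀ k * ½)
    (x*½-nonneg (prob≥0 b₀ k)) (x*½≤x (prob≥0 b₀ k))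

  b : ℕ → Application F n
  b zero    = b₀
  b (suc _) = transfer

  b-WT : ∀ i → WT F m (b (suc i)) (b i)
  b-WT zero    = transfer-WT m≤k (a₀l≉0 ∘ trans (a₀≈b₀ l)) (b₀k≉0 ∘ x*½≈x⇒x≈0)
  b-WT (suc _) = WT-refl F m transfer

  a≉b : ∀ i → ¬ (i ≡ 0) → ¬ ET F m a₀ (b i)
  a≉b zero    i≢0 _   = i≢0 ≡.refl
  a≉b (suc _) _   a≈b =
    transferred-target≉ (b₀k≉0 ∘ x*½≈0⇒x≈0) (trans (sym (a≈b l l<m)) (a₀≈b₀ l))
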